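{- Let $n,m\ge1$. The number of words of length $2n$ over a complementary alphabet with $m$ complementary pairs that have at least one $P$-valid plane tree is \[|\mathcal{P}(n,m)|=\sum_{\lambda=(\lambda_1,\dots,\lambda_k)}(2m)^k(2m-1)^{n-k}\prod_{i=1}^{k}C_{\lambda_i-1},\] where the sum runs over all compositions $\lambda=(\lambda_1,\dots,\lambda_k)$ of $n$ (ordered sequences of positive integers with $\lambda_1+\cdots+\lambda_k=n$, $k$ being the number of parts), and $C_r=\frac{1}{r+1}\binom{2r}{r}$ is the $r$-th Catalan number.
   Context: A complementary alphabet with $m$ complementary pairs is a set of $2m$ letters in which every letter $B$ has a unique complement $\overline{B}\neq B$ with $\overline{\overline{B}}=B$. A plane tree is a rooted tree with linearly ordered children at each vertex. For a plane tree with $n$ edges, the $2n$ half-edges are labeled $1,\dots,2n$ by starting on the left side of the leftmost root edge and walking counterclockwise; each edge is $e(i,j)$, $i<j$, with $i,j$ the labels of its sides. For $P=p_1\cdots p_{2n}$, a plane tree with $n$ edges is $P$-valid if $p_i,p_j$ are complements for every edge $e(i,j)$. $\mathcal{P}(n,m)$ denotes the set of words $P$ of length $2n$ over the alphabet for which at least one $P$-valid plane tree exists. -}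

module Defs where

open import Data.Nat using (ℕ; zero; suc; _+_; _*_; _∸_; _^_; _/_; _≤_)
open import Data.Nat.Combinatorics using (_C_)
open import Data.Fin using (Fin)
open import Data.Bool using (Bool; not)
open import Data.Product using (_×_; _,_; Σ; ∃)
open import Data.List using (List; []; _∷_; _++_; length; map)
open import Data.Nat.ListAction using (sum; product)
open import Data.List.Relation.Unary.All using (All)
open import Data.Vec using (Vec; []; _∷_)
open import Data.Maybe using (Maybe; just; nothing)
open import Relation.Binary.PropositionalEquality using (_≡_)

-- Complementary alphabet with m complementary pairs: the 2m letters (a , b),
-- a : Fin m, b : Bool; the complement of (a , b) is (a , not b).
-- (Every complementary alphabet with m pairs is isomorphic to this one.)
Letter : ℕ → Set
Letter m = Fin m × Bool

complement : ∀ {m} → Letter m → Letter m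
complement (a , b) = (a , not b)

data Tree : Set where
  node : List Tree → Tree

mutual
  edges : Tree → ℕ
  edges (node ts) = edgesF ts

  edgesF : List Tree → ℕ
  edgesF [] = 0
  edgesF (t ∷ ts) = suc (edges t) + edgesF ts

-- Edges e(i , j) (i < j are the labels of the two sides) of the subforest
-- whose first half-edge gets label s, obtained by walking around the tree
-- starting on the left side of the leftmost root edge.
mutual
  edgePairs : Tree → ℕ → List (ℕ × ℕ)
  edgePairs (node ts) s = edgePairsF ts s

  edgePairsF : List Tree → ℕ → List (ℕ × ℕ)
  edgePairsF [] s = []
  edgePairsF (t ∷ ts) s =
    (s , s + 2 * edges t + 1) ∷ (edgePairs t (suc s) ++ edgePairsF ts (s + 2 * edges t + 2))

treeEdges : Tree → List (ℕ × ℕ)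
treeEdges t = edgePairs t 1

-- 1-based letter lookup p_i in a word.
letterAt : ∀ {A : Set} {k} → Vec A k → ℕ → Maybe A
letterAt xs zero = nothing
letterAt [] (suc i) = nothing
letterAt (x ∷ xs) (suc zero) = just x
letterAt (x ∷ xs) (suc (suc i)) = letterAt xs (suc i)

Word : ℕ → ℕ → Set
Word n m = Vec (Letter m) (2 * n)

ComplementaryAt : ∀ n m → Word n m → ℕ × ℕ → Set
ComplementaryAt n m P (i , j) =
  Σ (Letter m) λ a → letterAt P i ≡ just a × letterAt P j ≡ just (complement a)

Valid : ∀ n m → Word n m → Tree → Set
Valid n m P t = edges t ≡ n × All (ComplementaryAt n m P) (treeEdges t)

InP : ∀ n m → Word n m → Set
InP n m P = ∃ λ t → Valid n m P t

IsComposition : ℕ → List ℕ → Set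
IsComposition n λs = All (1 ≤_) λs × sum λs ≡ n

catalan : ℕ → ℕ
catalan r = ((2 * r) C r) / suc r

term : ℕ → ℕ → List ℕ → ℕ
term n m λs =
  (2 * m) ^ length λs * (2 * m ∸ 1) ^ (n ∸ length λs) * product (map (λ l → catalan (l ∸ 1)) λs)

-- A word has a valid plane tree iff it is balanced, i.e. of the form x u x̄ v with u and v balanced,
-- the outer pair x … x̄ being the root edge of the first tree.  Equivalently, free reduction with a
-- stack (a letter cancels the top of the stack if it is its complement, and is pushed otherwise)
-- empties the stack.  Following the stack height turns these words of length 2n into lattice paths
-- in which an up-step from height 0 has 2m choices, any other up-step 2m − 1, and a down-step one.
-- Cutting a path at its returns to height 0 gives a composition λ of n, and a block of size λᵢ
-- contributes 2m (2m − 1)^(λᵢ − 1) times the number of Dyck paths of semilength λᵢ − 1, which the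
-- ballot formula identifies with the Catalan number C_(λᵢ − 1).

module Submission where

open import Defs
open import Data.Nat using (ℕ; _≤_)
open import Data.List using (List; length; map)
open import Data.Nat.ListAction using (sum)
open import Data.List.Relation.Unary.Unique.Propositional using (Unique)
open import Data.List.Membership.Propositional using (_∈_)
open import Data.Product using (_×_; ∃)
open import Function.Bundles using (_⇔_)
open import Relation.Binary.PropositionalEquality using (_≡_)

open import Data.Bool using (true; false)
import Data.Bool.Properties as Bool
import Data.Fin.Properties as Fin
open import Data.List using ([]; _∷_; _++_; head; foldl; allFin; cartesianProduct)
open import Data.List.Properties using (∷-injectiveʳ; ++-assoc; ++-identityʳ; map-++; map-∘; map-cong-local; length-++; length-map; length-tabulate; foldl-++)
open import Data.List.Membership.Propositional.Properties using (∈-++⁺ˡ; ∈-++⁺ʳ; ∈-++⁻; ∈-map⁺; ∈-map⁻; ∈-allFin; ∈-cartesianProduct⁺)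
open import Data.List.Relation.Binary.Disjoint.Propositional using (Disjoint)
open import Data.List.Relation.Unary.All using (All; []; _∷_)
import Data.List.Relation.Unary.All as All
open import Data.List.Relation.Unary.All.Properties using (++⁺; ++⁻; map⁺; map⁻)
open import Data.List.Relation.Unary.AllPairs using ([]; _∷_)
open import Data.List.Relation.Unary.Any using (here; there)
open import Data.List.Relation.Unary.Linked using (Linked; []; [-]; _∷_)
import Data.List.Relation.Unary.Linked as Linked
import Data.List.Relation.Unary.Unique.Propositional.Properties as Unique
open import Data.Maybe using (Maybe; just; nothing)
open import Data.Maybe.Relation.Unary.Any using (just) renaming (Any to AnyMaybe)
import Data.Maybe.Relation.Unary.Any as AnyMaybe
open import Data.Nat using (zero; suc; _+_; _*_; _∸_; _^_; _<_; z≤n; s≤s)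
open import Data.Nat.Combinatorics using (_C_; nCk+nC[k+1]≡[n+1]C[k+1]; nCk≡nC[n∸k]; nC1≡n)
open import Data.Nat.DivMod using (_/_; m*n/n≡m)
open import Data.Nat.Induction using (<-rec)
open import Data.Nat.ListAction using (product)
open import Data.Nat.ListAction.Properties using (sum-++)
open import Data.Nat.Properties hiding (_≟_)
open import Algebra.Properties.CommutativeSemigroup +-commutativeSemigroup using (x∙yz≈y∙xz) renaming (interchange to +-interchange)
open import Data.Nat.Tactic.RingSolver using (solve-∀)
open import Data.Product using (Σ; ∃₂; _,_; proj₁; proj₂)
open import Data.Product.Properties using (≡-dec)
open import Data.Sum using (inj₁; inj₂)
open import Data.Vec using (Vec; []; _∷_; toList)
import Data.Vec.Properties as Vecₚ
open import Function using (id; _∘_)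
open import Function.Bundles using (mk⇔; module Equivalence)
open import Function.Construct.Composition using (_⇔-∘_)
open import Relation.Binary.PropositionalEquality using (_≢_; refl; sym; trans; cong; cong₂; subst; module ≡-Reasoning)
open import Relation.Nullary using (yes; no; Dec; contradiction)

open ≡-Reasoning

length≤sum : ∀ {ns} → All (1 ≤_) ns → length ns ≤ sum ns
length≤sum []           = z≤n
length≤sum (n≥1 ∷ ns≥1) = +-mono-≤ n≥1 (length≤sum ns≥1)

sum-map-*ˡ : ∀ k ns → sum (map (k *_) ns) ≡ k * sum ns
sum-map-*ˡ k []       = sym (*-zeroʳ k)
sum-map-*ˡ k (n ∷ ns) = trans (cong (k * n +_) (sum-map-*ˡ k ns)) (sym (*-distribˡ-+ k n (sum ns)))

sum-map-≡ : ∀ {A : Set} (g : A → ℕ) {b xs} → All (λ x → g x ≡ b) xs → sum (map g xs) ≡ length xs * b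
sum-map-≡ g []             = refl
sum-map-≡ g (gx≡b ∷ gxs≡b) = cong₂ _+_ gx≡b (sum-map-≡ g gxs≡b)

sum-map-except : ∀ {A : Set} (g : A → ℕ) {e b xs} → (∀ x → x ≢ e → g x ≡ b) → Unique xs → e ∈ xs →
                 sum (map g xs) ≡ g e + (length xs ∸ 1) * b
sum-map-except g g≡b (x∉xs ∷ _) (here refl) =
  cong (g _ +_) (sum-map-≡ g (All.map (λ x≢y → g≡b _ (x≢y ∘ sym)) x∉xs))
sum-map-except g {e} {b} {x ∷ y ∷ xs} g≡b (x∉xs ∷ unique) (there e∈xs) = begin
  g x + sum (map g (y ∷ xs))        ≡⟨ cong₂ _+_ (g≡b x (All.lookup x∉xs e∈xs)) (sum-map-except g g≡b unique e∈xs) ⟩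
  b + (g e + length xs * b)         ≡⟨ x∙yz≈y∙xz b (g e) _ ⟩
  g e + (b + length xs * b)         ∎

++-length≡⇒[] : ∀ {A : Set} (w : List A) {post} → length (w ++ post) ≡ length w → post ≡ []
++-length≡⇒[] []      {[]} _ = refl
++-length≡⇒[] (_ ∷ w)      e = ++-length≡⇒[] w (suc-injective e)

length-cartesianProduct : ∀ {A B : Set} (xs : List A) (ys : List B) → length (cartesianProduct xs ys) ≡ length xs * length ys
length-cartesianProduct []       ys = refl
length-cartesianProduct (x ∷ xs) ys =
  trans (length-++ (map (x ,_) ys)) (cong₂ _+_ (length-map (x ,_) ys) (length-cartesianProduct xs ys))

module _ {A : Set} where

  consEach : ∀ {k} → List A → (A → List (Vec A k)) → List (Vec A (suc k))
  consEach []       ws = []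
  consEach (x ∷ xs) ws = map (x ∷_) (ws x) ++ consEach xs ws

  ∈-consEach⁺ : ∀ {k xs} (ws : A → List (Vec A k)) {x v} → x ∈ xs → v ∈ ws x → (x ∷ v) ∈ consEach xs ws
  ∈-consEach⁺ ws (here refl) v∈ = ∈-++⁺ˡ (∈-map⁺ (_ ∷_) v∈)
  ∈-consEach⁺ ws (there x∈)  v∈ = ∈-++⁺ʳ _ (∈-consEach⁺ ws x∈ v∈)

  ∈-consEach⁻ : ∀ {k} xs (ws : A → List (Vec A k)) {x v} → (x ∷ v) ∈ consEach xs ws → x ∈ xs × v ∈ ws x
  ∈-consEach⁻ (y ∷ xs) ws xv∈ with ∈-++⁻ (map (y ∷_) (ws y)) xv∈
  ... | inj₁ xv∈here with ∈-map⁻ (y ∷_) xv∈here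
  ...   | _ , v∈ , refl = here refl , v∈
  ∈-consEach⁻ (y ∷ xs) ws xv∈ | inj₂ xv∈rest with ∈-consEach⁻ xs ws xv∈rest
  ...   | x∈ , v∈ = there x∈ , v∈

  consEach-unique : ∀ {k xs} (ws : A → List (Vec A k)) → Unique xs → (∀ x → Unique (ws x)) → Unique (consEach xs ws)
  consEach-unique ws []             _        = []
  consEach-unique {xs = x ∷ xs} ws (x∉xs ∷ xs!) ws! =
    Unique.++⁺ (Unique.map⁺ Vecₚ.∷-injectiveʳ (ws! x)) (consEach-unique ws xs! ws!) disjoint
    where
    disjoint : Disjoint (map (x ∷_) (ws x)) (consEach xs ws)
    disjoint (v∈here , v∈rest) with ∈-map⁻ (x ∷_) v∈here
    ... | _ , _ , refl = All.lookup x∉xs (proj₁ (∈-consEach⁻ xs ws v∈rest)) refl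

  length-consEach : ∀ {k} xs (ws : A → List (Vec A k)) → length (consEach xs ws) ≡ sum (map (length ∘ ws) xs)
  length-consEach []       ws = refl
  length-consEach (x ∷ xs) ws = trans (length-++ (map (x ∷_) (ws x))) (cong₂ _+_ (length-map (x ∷_) (ws x)) (length-consEach xs ws))

  infixl 5 _!?_

  _!?_ : List A → ℕ → Maybe A
  []       !? _     = nothing
  (x ∷ xs) !? zero  = just x
  (x ∷ xs) !? suc i = xs !? i

  !?-++ʳ : ∀ pre {xs i j} → i ≡ length pre + j → (pre ++ xs) !? i ≡ xs !? j
  !?-++ʳ []        refl = refl
  !?-++ʳ (_ ∷ pre) refl = !?-++ʳ pre refl

  !?-++ˡ : ∀ xs {ys i a} → xs !? i ≡ just a → (xs ++ ys) !? i ≡ just a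
  !?-++ˡ (x ∷ xs) {i = zero}  xs!?i≡a = xs!?i≡a
  !?-++ˡ (x ∷ xs) {i = suc i} xs!?i≡a = !?-++ˡ xs xs!?i≡a

  !?0≡just⇒≡∷ : ∀ {xs a} → xs !? 0 ≡ just a → ∃ λ rest → xs ≡ a ∷ rest
  !?0≡just⇒≡∷ {x ∷ xs} refl = xs , refl

  letterAt-toList : ∀ {k} (v : Vec A k) i → letterAt v (suc i) ≡ toList v !? i
  letterAt-toList []      _       = refl
  letterAt-toList (x ∷ v) zero    = refl
  letterAt-toList (x ∷ v) (suc i) = letterAt-toList v i

-- Convolution, binomial coefficients and ballot numbers

-- conv a b u = Σ_{j ≤ u} a j * b (u ∸ j)
conv : (ℕ → ℕ) → (ℕ → ℕ) → ℕ → ℕ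
conv a b zero    = a 0 * b 0
conv a b (suc u) = a 0 * b (suc u) + conv (a ∘ suc) b u

conv-congˡ : ∀ {a a′} b u → (∀ j → a j ≡ a′ j) → conv a b u ≡ conv a′ b u
conv-congˡ b zero    a≗a′ = cong (_* b 0) (a≗a′ 0)
conv-congˡ b (suc u) a≗a′ = cong₂ _+_ (cong (_* b (suc u)) (a≗a′ 0)) (conv-congˡ b u (a≗a′ ∘ suc))

conv-congʳ : ∀ a {b b′} u → (∀ j → j ≤ u → b j ≡ b′ j) → conv a b u ≡ conv a b′ u
conv-congʳ a zero    b≗b′ = cong (a 0 *_) (b≗b′ 0 z≤n)
conv-congʳ a (suc u) b≗b′ =
  cong₂ _+_ (cong (a 0 *_) (b≗b′ (suc u) ≤-refl)) (conv-congʳ (a ∘ suc) u (λ j j≤u → b≗b′ j (m≤n⇒m≤1+n j≤u)))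

conv-0ˡ : ∀ b u → conv (λ _ → 0) b u ≡ 0
conv-0ˡ b zero    = refl
conv-0ˡ b (suc u) = conv-0ˡ b u

conv-+ˡ : ∀ a c b u → conv (λ j → a j + c j) b u ≡ conv a b u + conv c b u
conv-+ˡ a c b zero    = *-distribʳ-+ (b 0) (a 0) (c 0)
conv-+ˡ a c b (suc u) = begin
  (a 0 + c 0) * b (suc u) + conv (λ j → a (suc j) + c (suc j)) b u
    ≡⟨ cong₂ _+_ (*-distribʳ-+ (b (suc u)) (a 0) (c 0)) (conv-+ˡ (a ∘ suc) (c ∘ suc) b u) ⟩
  (a 0 * b (suc u) + c 0 * b (suc u)) + (conv (a ∘ suc) b u + conv (c ∘ suc) b u)
    ≡⟨ +-interchange (a 0 * b (suc u)) _ _ _ ⟩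
  conv a b (suc u) + conv c b (suc u) ∎

conv-*ˡ : ∀ k a b u → conv (λ j → k * a j) b u ≡ k * conv a b u
conv-*ˡ k a b zero    = *-assoc k (a 0) (b 0)
conv-*ˡ k a b (suc u) = begin
  k * a 0 * b (suc u) + conv (λ j → k * a (suc j)) b u
    ≡⟨ cong₂ _+_ (*-assoc k (a 0) (b (suc u))) (conv-*ˡ k (a ∘ suc) b u) ⟩
  k * (a 0 * b (suc u)) + k * conv (a ∘ suc) b u
    ≡⟨ *-distribˡ-+ k (a 0 * b (suc u)) _ ⟨
  k * conv a b (suc u) ∎

infixl 6.5 _C₋₁_

-- N C₋₁ u is N C (u − 1), with value 0 at u = 0 (unlike N C (u ∸ 1)).
_C₋₁_ : ℕ → ℕ → ℕ
N C₋₁ zero  = 0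
N C₋₁ suc u = N C u

[1+n]Ck≡nC₋₁k+nCk : ∀ n k → suc n C k ≡ n C₋₁ k + n C k
[1+n]Ck≡nC₋₁k+nCk n zero    = refl
[1+n]Ck≡nC₋₁k+nCk n (suc k) = sym (nCk+nC[k+1]≡[n+1]C[k+1] n k)

[k+[1+k]]Ck≡[k+[1+k]]C[1+k] : ∀ k → (k + suc k) C k ≡ (k + suc k) C suc k
[k+[1+k]]Ck≡[k+[1+k]]C[1+k] k = begin
  (k + suc k) C k                  ≡⟨ nCk≡nC[n∸k] (m≤m+n k (suc k)) ⟩
  (k + suc k) C (k + suc k ∸ k)    ≡⟨ cong ((k + suc k) C_) (m+n∸m≡n k (suc k)) ⟩
  (k + suc k) C suc k              ∎

[1+k]*[1+n]C[1+k]≡[1+n]*nCk : ∀ n k → suc k * (suc n C suc k) ≡ suc n * (n C k)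
[1+k]*[1+n]C[1+k]≡[1+n]*nCk zero    zero    = refl
[1+k]*[1+n]C[1+k]≡[1+n]*nCk zero    (suc k) = *-zeroʳ (2 + k)
[1+k]*[1+n]C[1+k]≡[1+n]*nCk (suc n) zero    = trans (+-identityʳ _) (trans (nC1≡n (2 + n)) (sym (*-identityʳ (2 + n))))
[1+k]*[1+n]C[1+k]≡[1+n]*nCk (suc n) (suc k) = begin
  (2 + k) * ((2 + n) C (2 + k))                    ≡⟨ cong ((2 + k) *_) (nCk+nC[k+1]≡[n+1]C[k+1] (suc n) (suc k)) ⟨
  (2 + k) * (X + Y)                                ≡⟨ split (suc k) X Y ⟩
  (1 + k) * X + (X + (2 + k) * Y)                  ≡⟨ cong₂ (λ a b → a + (X + b)) ([1+k]*[1+n]C[1+k]≡[1+n]*nCk n k)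
                                                                                  ([1+k]*[1+n]C[1+k]≡[1+n]*nCk n (suc k)) ⟩
  (1 + n) * (n C k) + (X + (1 + n) * (n C suc k))  ≡⟨ regroup (suc n) (n C k) (n C suc k) X ⟩
  (1 + n) * (n C k + n C suc k) + X                ≡⟨ cong (λ z → (1 + n) * z + X) (nCk+nC[k+1]≡[n+1]C[k+1] n k) ⟩
  (1 + n) * X + X                                  ≡⟨ +-comm ((1 + n) * X) X ⟩
  (2 + n) * X                                      ∎
  where
  X Y : ℕ
  X = suc n C suc k
  Y = suc n C suc (suc k)
  split : ∀ k x y → suc k * (x + y) ≡ k * x + (x + suc k * y)
  split = solve-∀
  regroup : ∀ n a b x → n * a + (x + n * b) ≡ n * (a + b) + x
  regroup = solve-∀

[2+i]*NCi≡[1+i]*NC[1+i] : ∀ i → let N = suc (i + suc i) in (2 + i) * (N C i) ≡ (1 + i) * (N C suc i)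
[2+i]*NCi≡[1+i]*NC[1+i] i = begin
  (2 + i) * (N C i)           ≡⟨ cong ((2 + i) *_) N-symmetry ⟩
  (2 + i) * (N C (2 + i))     ≡⟨ [1+k]*[1+n]C[1+k]≡[1+n]*nCk M (suc i) ⟩
  N * (M C suc i)             ≡⟨ cong (N *_) ([k+[1+k]]Ck≡[k+[1+k]]C[1+k] i) ⟨
  N * (M C i)                 ≡⟨ [1+k]*[1+n]C[1+k]≡[1+n]*nCk M i ⟨
  (1 + i) * (N C suc i)       ∎
  where
  M N : ℕ
  M = i + suc i
  N = suc M
  N-symmetry : N C i ≡ N C (2 + i)
  N-symmetry = trans (nCk≡nC[n∸k] i≤N) (cong (N C_) N∸i≡2+i)
    where
    N≡i+[2+i] : N ≡ i + (2 + i)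
    N≡i+[2+i] = sym (+-suc i (suc i))
    i≤N : i ≤ N
    i≤N = subst (i ≤_) (sym N≡i+[2+i]) (m≤m+n i (2 + i))
    N∸i≡2+i : N ∸ i ≡ 2 + i
    N∸i≡2+i = trans (cong (_∸ i) N≡i+[2+i]) (m+n∸m≡n i (2 + i))

x/[1+d]+y≡x : ∀ d {x y} → suc d * y ≡ d * x → x / suc d + y ≡ x
x/[1+d]+y≡x d {x} {y} [1+d]y≡dx = begin
  x / suc d + y        ≡⟨ cong (λ z → z / suc d + y) [1+d][x∸y]≡x ⟨
  suc d * (x ∸ y) / suc d + y
                       ≡⟨ cong (_+ y) (trans (cong (_/ suc d) (*-comm (suc d) (x ∸ y))) (m*n/n≡m (x ∸ y) (suc d))) ⟩
  x ∸ y + y            ≡⟨ m∸n+n≡m y≤x ⟩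
  x                    ∎
  where
  y≤x : y ≤ x
  y≤x = *-cancelˡ-≤ (suc d) (subst (_≤ suc d * x) (sym [1+d]y≡dx) (*-monoˡ-≤ x (n≤1+n d)))
  [1+d][x∸y]≡x : suc d * (x ∸ y) ≡ x
  [1+d][x∸y]≡x = begin
    suc d * (x ∸ y)        ≡⟨ *-distribˡ-∸ (suc d) x y ⟩
    suc d * x ∸ suc d * y  ≡⟨ cong (suc d * x ∸_) [1+d]y≡dx ⟩
    x + d * x ∸ d * x      ≡⟨ m+n∸n≡m x (d * x) ⟩
    x                      ∎

catalan+2jC₋₁j≡2jCj : ∀ j → catalan j + (2 * j) C₋₁ j ≡ (2 * j) C j
catalan+2jC₋₁j≡2jCj zero    = refl
catalan+2jC₋₁j≡2jCj (suc i) =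
  x/[1+d]+y≡x (suc i) (subst (λ N → (2 + i) * (N C i) ≡ (1 + i) * (N C suc i)) N≡2[1+i] ([2+i]*NCi≡[1+i]*NC[1+i] i))
  where
  N≡2[1+i] : suc (i + suc i) ≡ 2 * suc i
  N≡2[1+i] = cong (λ k → suc (i + suc k)) (sym (+-identityʳ i))

-- Paths from height d that first reach 0 at their last step and use u up-steps, each weighted q.
firstPassages : ℕ → ℕ → ℕ → ℕ
firstPassages q zero    zero    = 1
firstPassages q zero    (suc u) = 0
firstPassages q (suc d) zero    = firstPassages q d zero
firstPassages q (suc d) (suc u) = firstPassages q d (suc u) + q * firstPassages q (suc (suc d)) u

firstPassages-zero : ∀ q d → firstPassages q d 0 ≡ 1
firstPassages-zero q zero    = refl
firstPassages-zero q (suc d) = firstPassages-zero q d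

firstPassages-homogeneous : ∀ q d u → firstPassages q d u ≡ q ^ u * firstPassages 1 d u
firstPassages-homogeneous q d       zero    = trans (firstPassages-zero q d) (cong (_+ 0) (sym (firstPassages-zero 1 d)))
firstPassages-homogeneous q zero    (suc u) = sym (*-zeroʳ (q ^ suc u))
firstPassages-homogeneous q (suc d) (suc u) = begin
  firstPassages q d (suc u) + q * firstPassages q (suc (suc d)) u
    ≡⟨ cong₂ (λ a b → a + q * b) (firstPassages-homogeneous q d (suc u)) (firstPassages-homogeneous q (suc (suc d)) u) ⟩
  q * q ^ u * firstPassages 1 d (suc u) + q * (q ^ u * firstPassages 1 (suc (suc d)) u)
    ≡⟨ factor q (q ^ u) _ _ ⟩
  q * q ^ u * (firstPassages 1 d (suc u) + 1 * firstPassages 1 (suc (suc d)) u) ∎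
  where
  factor : ∀ q Q a b → q * Q * a + q * (Q * b) ≡ q * Q * (a + 1 * b)
  factor = solve-∀

ballot-step : ∀ {M u G₁ G₂} → G₁ + M C u ≡ M C suc u → G₂ + M C₋₁ u ≡ M C u →
              G₁ + 1 * G₂ + suc M C u ≡ suc M C suc u
ballot-step {M} {u} {G₁} {G₂} down up = begin
  G₁ + 1 * G₂ + suc M C u                ≡⟨ cong (G₁ + 1 * G₂ +_) ([1+n]Ck≡nC₋₁k+nCk M u) ⟩
  G₁ + 1 * G₂ + (M C₋₁ u + M C u)        ≡⟨ regroup G₁ G₂ (M C₋₁ u) (M C u) ⟩
  (G₁ + M C u) + (G₂ + M C₋₁ u)          ≡⟨ cong₂ _+_ down up ⟩
  M C suc u + M C u                      ≡⟨ +-comm (M C suc u) (M C u) ⟩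
  M C u + M C suc u                      ≡⟨ nCk+nC[k+1]≡[n+1]C[k+1] M u ⟩
  suc M C suc u                          ∎
  where
  regroup : ∀ a b c d → a + 1 * b + (c + d) ≡ (a + d) + (b + c)
  regroup = solve-∀

ballot : ∀ d u → firstPassages 1 (suc d) u + (u + u + d) C₋₁ u ≡ (u + u + d) C u
ballot-reindexed : ∀ d u → firstPassages 1 (2 + d) u + (u + suc u + d) C₋₁ u ≡ (u + suc u + d) C u

ballot d       zero    = cong (_+ 0) (firstPassages-zero 1 (suc d))
ballot zero    (suc u) = ballot-step {u + suc u + 0} {u}
  (subst (λ M → M C u ≡ M C suc u) (sym (+-identityʳ (u + suc u))) ([k+[1+k]]Ck≡[k+[1+k]]C[1+k] u))
  (ballot-reindexed 0 u)
ballot (suc d) (suc u) = ballot-step {u + suc u + suc d} {u}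
  (subst (λ M → firstPassages 1 (suc d) (suc u) + M C u ≡ M C suc u) (sym (+-suc (u + suc u) d)) (ballot d (suc u)))
  (ballot-reindexed (suc d) u)

ballot-reindexed d u =
  subst (λ N → firstPassages 1 (2 + d) u + N C₋₁ u ≡ N C u) (u+u+[1+d]≡u+[1+u]+d u d) (ballot (suc d) u)
  where
  u+u+[1+d]≡u+[1+u]+d : ∀ u d → u + u + suc d ≡ u + suc u + d
  u+u+[1+d]≡u+[1+u]+d = solve-∀

firstPassages-catalan : ∀ j → firstPassages 1 1 j ≡ catalan j
firstPassages-catalan j = +-cancelʳ-≡ ((2 * j) C₋₁ j) _ _ (begin
  firstPassages 1 1 j + (2 * j) C₋₁ j  ≡⟨ subst (λ N → firstPassages 1 1 j + N C₋₁ j ≡ N C j) (2j≡j+j+0 j) (ballot 0 j) ⟩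
  (2 * j) C j                          ≡⟨ catalan+2jC₋₁j≡2jCj j ⟨
  catalan j + (2 * j) C₋₁ j            ∎)
  where
  2j≡j+j+0 : ∀ j → j + j + 0 ≡ 2 * j
  2j≡j+j+0 = solve-∀

firstPassages-from-1 : ∀ q j → firstPassages q 1 j ≡ q ^ j * catalan j
firstPassages-from-1 q j = trans (firstPassages-homogeneous q 1 j) (cong (q ^ j *_) (firstPassages-catalan j))

-- Lattice paths and compositions

-- Weighted paths on ℕ (up-steps weigh a from height 0 and q elsewhere, down-steps weigh 1) from height d down to 0,
-- counted by length k in paths and by number of up-steps u (length u + u + d) in pathsByUps.
module Paths (a q : ℕ) where

  paths : ℕ → ℕ → ℕ
  paths zero    zero    = 1
  paths (suc d) zero    = 0
  paths zero    (suc k) = a * paths 1 k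
  paths (suc d) (suc k) = paths d k + q * paths (suc (suc d)) k

  pathsByUps : ℕ → ℕ → ℕ
  pathsByUps zero    zero    = 1
  pathsByUps zero    (suc u) = a * pathsByUps 1 u
  pathsByUps (suc d) zero    = pathsByUps d zero
  pathsByUps (suc d) (suc u) = pathsByUps d (suc u) + q * pathsByUps (suc (suc d)) u

  paths-short : ∀ {d k} → k < d → paths d k ≡ 0
  paths-short {suc d} {zero}  _         = refl
  paths-short {suc d} {suc k} (s≤s k<d) = begin
    paths d k + q * paths (suc (suc d)) k  ≡⟨ cong₂ (λ x y → x + q * y) (paths-short k<d) (paths-short (m<n⇒m<1+n (m<n⇒m<1+n k<d))) ⟩
    q * 0                                  ≡⟨ *-zeroʳ q ⟩
    0                                      ∎

  paths≡pathsByUps : ∀ d u → paths d (u + u + d) ≡ pathsByUps d u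
  paths≡pathsByUps zero    zero    = refl
  paths≡pathsByUps zero    (suc u) =
    cong (a *_) (trans (cong (paths 1) (u+[1+u]+0≡u+u+1 u)) (paths≡pathsByUps 1 u))
    where
    u+[1+u]+0≡u+u+1 : ∀ u → u + suc u + 0 ≡ u + u + 1
    u+[1+u]+0≡u+u+1 = solve-∀
  paths≡pathsByUps (suc d) zero    =
    trans (cong (paths d d +_) (trans (cong (q *_) (paths-short (m<n⇒m<1+n (n<1+n d)))) (*-zeroʳ q)))
          (trans (+-identityʳ _) (paths≡pathsByUps d zero))
  paths≡pathsByUps (suc d) (suc u) = cong₂ (λ x y → x + q * y)
    (trans (cong (paths d) (down u d)) (paths≡pathsByUps d (suc u)))
    (trans (cong (paths (suc (suc d))) (up u d)) (paths≡pathsByUps (suc (suc d)) u))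
    where
    down : ∀ u d → u + suc u + suc d ≡ suc u + suc u + d
    down = solve-∀
    up : ∀ u d → u + suc u + suc d ≡ u + u + suc (suc d)
    up = solve-∀

  -- Split a path at its first visit to height 0.
  pathsByUps≡conv : ∀ d u → pathsByUps d u ≡ conv (firstPassages q d) (pathsByUps 0) u
  pathsByUps≡conv zero    zero    = refl
  pathsByUps≡conv zero    (suc u) = sym (begin
    1 * pathsByUps 0 (suc u) + conv (λ _ → 0) (pathsByUps 0) u ≡⟨ cong₂ _+_ (*-identityˡ _) (conv-0ˡ (pathsByUps 0) u) ⟩
    pathsByUps 0 (suc u) + 0                                  ≡⟨ +-identityʳ _ ⟩
    pathsByUps 0 (suc u)                                      ∎)
  pathsByUps≡conv (suc d) zero    = pathsByUps≡conv d zero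
  pathsByUps≡conv (suc d) (suc u) = begin
    pathsByUps d (suc u) + q * pathsByUps (suc (suc d)) u
      ≡⟨ cong₂ (λ x y → x + q * y) (pathsByUps≡conv d (suc u)) (pathsByUps≡conv (suc (suc d)) u) ⟩
    G d 0 * F (suc u) + conv (G d ∘ suc) F u + q * conv (G (suc (suc d))) F u
      ≡⟨ +-assoc (G d 0 * F (suc u)) _ _ ⟩
    G d 0 * F (suc u) + (conv (G d ∘ suc) F u + q * conv (G (suc (suc d))) F u)
      ≡⟨ cong (G d 0 * F (suc u) +_) (cong (conv (G d ∘ suc) F u +_) (conv-*ˡ q (G (suc (suc d))) F u)) ⟨
    G d 0 * F (suc u) + (conv (G d ∘ suc) F u + conv (λ j → q * G (suc (suc d)) j) F u)
      ≡⟨ cong (G d 0 * F (suc u) +_) (conv-+ˡ (G d ∘ suc) (λ j → q * G (suc (suc d)) j) F u) ⟨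
    conv (G (suc d)) F (suc u) ∎
    where
    F : ℕ → ℕ
    F = pathsByUps 0
    G : ℕ → ℕ → ℕ
    G = firstPassages q

-- compositionsFrom l u lists the compositions of suc l + u whose first part is at least suc l.
mutual
  compositions : ℕ → List (List ℕ)
  compositions zero    = [] ∷ []
  compositions (suc u) = compositionsFrom 0 u

  compositionsFrom : ℕ → ℕ → List (List ℕ)
  compositionsFrom l zero    = (suc l ∷ []) ∷ []
  compositionsFrom l (suc u) = map (suc l ∷_) (compositions (suc u)) ++ compositionsFrom (suc l) u

mutual
  compositions-sound : ∀ n → All (IsComposition n) (compositions n)
  compositions-sound zero    = ([] , refl) ∷ []
  compositions-sound (suc u) = compositionsFrom-sound 0 u

  compositionsFrom-sound : ∀ l u → All (IsComposition (suc l + u)) (compositionsFrom l u)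
  compositionsFrom-sound l zero    = ((s≤s z≤n ∷ []) , refl) ∷ []
  compositionsFrom-sound l (suc u) = ++⁺
    (map⁺ (All.map (λ { (parts≥1 , sum≡) → (s≤s z≤n ∷ parts≥1) , cong (suc l +_) sum≡ }) (compositions-sound (suc u))))
    (subst (λ N → All (IsComposition N) (compositionsFrom (suc l) u)) (sym (+-suc (suc l) u)) (compositionsFrom-sound (suc l) u))

compositionsFrom-head : ∀ l u → All (AnyMaybe (suc l ≤_) ∘ head) (compositionsFrom l u)
compositionsFrom-head l zero    = just ≤-refl ∷ []
compositionsFrom-head l (suc u) = ++⁺
  (map⁺ (All.tabulate (λ _ → just ≤-refl)))
  (All.map (AnyMaybe.map <⇒≤) (compositionsFrom-head (suc l) u))

mutual
  compositions-unique : ∀ n → Unique (compositions n)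
  compositions-unique zero    = [] ∷ []
  compositions-unique (suc u) = compositionsFrom-unique 0 u

  compositionsFrom-unique : ∀ l u → Unique (compositionsFrom l u)
  compositionsFrom-unique l zero    = [] ∷ []
  compositionsFrom-unique l (suc u) =
    Unique.++⁺ (Unique.map⁺ ∷-injectiveʳ (compositions-unique (suc u))) (compositionsFrom-unique (suc l) u) disjoint
    where
    disjoint : Disjoint (map (suc l ∷_) (compositions (suc u))) (compositionsFrom (suc l) u)
    disjoint (c∈here , c∈later) with ∈-map⁻ (suc l ∷_) c∈here
    ... | _ , _ , refl with just l<l ← All.lookup (compositionsFrom-head (suc l) u) c∈later = <-irrefl refl l<l

mutual
  ∈-compositions⁺ : ∀ {n c} → IsComposition n c → c ∈ compositions n
  ∈-compositions⁺ {zero}  {[]}    _                     = here refl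
  ∈-compositions⁺ {zero}  {p ∷ c} (p≥1 ∷ _ , p+Σc≡0)    with () ← ≤-trans p≥1 (subst (p ≤_) p+Σc≡0 (m≤m+n p (sum c)))
  ∈-compositions⁺ {suc u} {[]}    (_ , ())
  ∈-compositions⁺ {suc u} {p ∷ c} (p≥1 ∷ parts≥1 , sum≡) = ∈-compositionsFrom⁺ p≥1 parts≥1 sum≡

  ∈-compositionsFrom⁺ : ∀ {l u p c} → suc l ≤ p → All (1 ≤_) c → p + sum c ≡ suc l + u → (p ∷ c) ∈ compositionsFrom l u
  ∈-compositionsFrom⁺ {l} {zero}  {p} {[]}    _ _ sum≡ = here (cong (_∷ []) (trans (sym (+-identityʳ p)) (trans sum≡ (+-identityʳ _))))
  ∈-compositionsFrom⁺ {l} {zero}  {p} {x ∷ c} l<p (x≥1 ∷ _) sum≡ with () ← +-cancelˡ-≤ (suc l) 1 0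
      (subst (suc l + 1 ≤_) sum≡ (+-mono-≤ l<p (≤-trans x≥1 (m≤m+n x (sum c)))))
  ∈-compositionsFrom⁺ {l} {suc u} l<p parts≥1 sum≡ with m≤n⇒m<n∨m≡n l<p
  ... | inj₂ refl = ∈-++⁺ˡ (∈-map⁺ (suc l ∷_) (∈-compositions⁺ (parts≥1 , +-cancelˡ-≡ (suc l) _ (suc u) sum≡)))
  ... | inj₁ l+1<p = ∈-++⁺ʳ _ (∈-compositionsFrom⁺ l+1<p parts≥1 (trans sum≡ (+-suc (suc l) u)))

module CompositionSum (a q : ℕ) where

  open Paths a q

  -- For a = 2m and q = 2m ∸ 1, weight n is definitionally Defs.term n m.
  weight : ℕ → List ℕ → ℕ
  weight n λs = a ^ length λs * q ^ (n ∸ length λs) * product (map (λ l → catalan (l ∸ 1)) λs)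

  blockWeight : ℕ → ℕ
  blockWeight j = a * (q ^ j * catalan j)

  compositionSum : ℕ → ℕ
  compositionSum n = sum (map (weight n) (compositions n))

  weight-∷ : ∀ l {n c} → IsComposition n c → weight (suc l + n) (suc l ∷ c) ≡ blockWeight l * weight n c
  weight-∷ l {n} {c} (parts≥1 , sum≡n) = begin
    a * A * q ^ (l + n ∸ length c) * (catalan l * P)     ≡⟨ cong (λ k → a * A * q ^ k * (catalan l * P)) (+-∸-assoc l length≤n) ⟩
    a * A * q ^ (l + (n ∸ length c)) * (catalan l * P)   ≡⟨ cong (λ x → a * A * x * (catalan l * P)) (^-distribˡ-+-* q l (n ∸ length c)) ⟩
    a * A * (q ^ l * Q) * (catalan l * P)                 ≡⟨ regroup a A (q ^ l) Q (catalan l) P ⟩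
    a * (q ^ l * catalan l) * (A * Q * P)                 ∎
    where
    A Q P : ℕ
    A = a ^ length c
    Q = q ^ (n ∸ length c)
    P = product (map (λ l → catalan (l ∸ 1)) c)
    length≤n : length c ≤ n
    length≤n = subst (length c ≤_) sum≡n (length≤sum parts≥1)
    regroup : ∀ a A Ql Q Cl P → a * A * (Ql * Q) * (Cl * P) ≡ a * (Ql * Cl) * (A * Q * P)
    regroup = solve-∀

  compositionsFrom-sum : ∀ l u → sum (map (weight (suc l + u)) (compositionsFrom l u)) ≡ conv (blockWeight ∘ (l +_)) compositionSum u
  compositionsFrom-sum l zero    = trans (+-identityʳ _) (trans (weight-∷ l ([] , refl))
                                     (cong₂ _*_ (cong blockWeight (sym (+-identityʳ l))) (sym (+-identityʳ _))))
  compositionsFrom-sum l (suc u) = begin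
    sum (map W (map (suc l ∷_) (compositions (suc u)) ++ compositionsFrom (suc l) u))
      ≡⟨ cong sum (map-++ W (map (suc l ∷_) (compositions (suc u))) _) ⟩
    sum (map W (map (suc l ∷_) (compositions (suc u))) ++ map W (compositionsFrom (suc l) u))
      ≡⟨ sum-++ (map W (map (suc l ∷_) (compositions (suc u)))) _ ⟩
    sum (map W (map (suc l ∷_) (compositions (suc u)))) + sum (map W (compositionsFrom (suc l) u))
      ≡⟨ cong₂ _+_ first rest ⟩
    blockWeight l * compositionSum (suc u) + conv (blockWeight ∘ (suc l +_)) compositionSum u
      ≡⟨ cong₂ _+_ (cong (λ j → blockWeight j * compositionSum (suc u)) (sym (+-identityʳ l)))
                   (conv-congˡ compositionSum u (λ j → cong blockWeight (sym (+-suc l j)))) ⟩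
    conv (blockWeight ∘ (l +_)) compositionSum (suc u) ∎
    where
    W : List ℕ → ℕ
    W = weight (suc l + suc u)
    first : sum (map W (map (suc l ∷_) (compositions (suc u)))) ≡ blockWeight l * compositionSum (suc u)
    first = begin
      sum (map W (map (suc l ∷_) (compositions (suc u))))       ≡⟨ cong sum (map-∘ (compositions (suc u))) ⟨
      sum (map (W ∘ (suc l ∷_)) (compositions (suc u)))         ≡⟨ cong sum (map-cong-local (All.map (weight-∷ l) (compositions-sound (suc u)))) ⟩
      sum (map ((blockWeight l *_) ∘ weight (suc u)) (compositions (suc u)))
                                                                ≡⟨ cong sum (map-∘ (compositions (suc u))) ⟩
      sum (map (blockWeight l *_) (map (weight (suc u)) (compositions (suc u))))
                                                                ≡⟨ sum-map-*ˡ (blockWeight l) (map (weight (suc u)) (compositions (suc u))) ⟩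
      blockWeight l * compositionSum (suc u)                    ∎
    rest : sum (map W (compositionsFrom (suc l) u)) ≡ conv (blockWeight ∘ (suc l +_)) compositionSum u
    rest = trans (cong (λ N → sum (map (weight N) (compositionsFrom (suc l) u))) (+-suc (suc l) u)) (compositionsFrom-sum (suc l) u)

  compositionSum≡pathsByUps : ∀ n → compositionSum n ≡ pathsByUps 0 n
  compositionSum≡pathsByUps = <-rec _ λ where
    zero    _   → refl
    (suc u) rec → begin
      compositionSum (suc u)                          ≡⟨ compositionsFrom-sum 0 u ⟩
      conv blockWeight compositionSum u               ≡⟨ conv-congʳ blockWeight u (λ _ j≤u → rec (s≤s j≤u)) ⟩
      conv blockWeight (pathsByUps 0) u               ≡⟨ conv-congˡ (pathsByUps 0) u (λ j → cong (a *_) (sym (firstPassages-from-1 q j))) ⟩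
      conv (λ j → a * firstPassages q 1 j) (pathsByUps 0) u
                                                      ≡⟨ conv-*ˡ a (firstPassages q 1) (pathsByUps 0) u ⟩
      a * conv (firstPassages q 1) (pathsByUps 0) u   ≡⟨ cong (a *_) (pathsByUps≡conv 1 u) ⟨
      a * pathsByUps 1 u                              ∎

-- Free reduction

complement-involutive : ∀ {m} (x : Letter m) → complement (complement x) ≡ x
complement-involutive (_ , true)  = refl
complement-involutive (_ , false) = refl

module FreeReduction (m : ℕ) where

  L : Set
  L = Letter m

  _≟_ : (x y : L) → Dec (x ≡ y)
  _≟_ = ≡-dec Fin._≟_ Bool._≟_

  letters : List L
  letters = cartesianProduct (allFin m) (true ∷ false ∷ [])

  ∈-letters : ∀ x → x ∈ letters
  ∈-letters (a , b) = ∈-cartesianProduct⁺ (∈-allFin a) (∈-bools b)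
    where
    ∈-bools : ∀ b → b ∈ true ∷ false ∷ []
    ∈-bools true  = here refl
    ∈-bools false = there (here refl)

  letters-unique : Unique letters
  letters-unique = Unique.cartesianProduct⁺ (Unique.allFin⁺ m) (((λ ()) ∷ []) ∷ [] ∷ [])

  length-letters : length letters ≡ 2 * m
  length-letters = trans (length-cartesianProduct (allFin m) _) (trans (cong (_* 2) (length-tabulate {n = m} id)) (*-comm m 2))

  -- Stacks are listed top first.
  step : List L → L → List L
  step []      x = x ∷ []
  step (c ∷ t) x with x ≟ complement c
  ... | yes _ = t
  ... | no  _ = x ∷ c ∷ t

  reduce : List L → List L → List L
  reduce = foldl step

  step-cancel : ∀ {c t x} → x ≡ complement c → step (c ∷ t) x ≡ t
  step-cancel {c} {t} {x} x≡c̄ with x ≟ complement c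
  ... | yes _   = refl
  ... | no  x≢c̄ = contradiction x≡c̄ x≢c̄

  step-push : ∀ {c t x} → x ≢ complement c → step (c ∷ t) x ≡ x ∷ c ∷ t
  step-push {c} {t} {x} x≢c̄ with x ≟ complement c
  ... | yes x≡c̄ = contradiction x≡c̄ x≢c̄
  ... | no  _   = refl

  Reduced : List L → Set
  Reduced = Linked (λ top below → top ≢ complement below)

  step-reduced : ∀ {s} x → Reduced s → Reduced (step s x)
  step-reduced {[]}    x _ = [-]
  step-reduced {c ∷ t} x r with x ≟ complement c
  ... | yes _   = Linked.tail r
  ... | no  x≢c̄ = x≢c̄ ∷ r

  step-step-complement : ∀ {s} x → Reduced s → step (step s x) (complement x) ≡ s
  step-step-complement {[]}    x _ = step-cancel refl
  step-step-complement {c ∷ t} x r with x ≟ complement c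
  ... | no  _    = step-cancel refl
  ... | yes refl with t | r
  ...   | []    | _       = cong (_∷ []) (complement-involutive c)
  ...   | d ∷ _ | c≢d̄ ∷ _ = trans (cong (λ y → step (d ∷ _) y) (complement-involutive c)) (step-push c≢d̄)

  data Balanced : List L → Set where
    []   : Balanced []
    wrap : ∀ x {u v} → Balanced u → Balanced v → Balanced (x ∷ u ++ complement x ∷ v)

  reduce-balanced : ∀ {w} → Balanced w → ∀ {s} → Reduced s → reduce s w ≡ s
  reduce-balanced []                         _ = refl
  reduce-balanced (wrap x {u} {v} bu bv) {s} r = begin
    reduce (step s x) (u ++ complement x ∷ v)          ≡⟨ foldl-++ step (step s x) u (complement x ∷ v) ⟩
    reduce (reduce (step s x) u) (complement x ∷ v)    ≡⟨ cong (λ t → reduce t (complement x ∷ v)) (reduce-balanced bu (step-reduced x r)) ⟩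
    reduce (step (step s x) (complement x)) v          ≡⟨ cong (λ t → reduce t v) (step-step-complement x r) ⟩
    reduce s v                                         ≡⟨ reduce-balanced bv r ⟩
    s                                                  ∎

  -- Closes (c₁ ∷ … ∷ cₖ) w: w = v₀ c̄₁ v₁ c̄₂ … c̄ₖ vₖ with all vᵢ balanced.
  data Closes : List L → List L → Set where
    done  : ∀ {v} → Balanced v → Closes [] v
    close : ∀ {c t v w} → Balanced v → Closes t w → Closes (c ∷ t) (v ++ complement c ∷ w)

  closes-wrap : ∀ x {u s w} → Balanced u → Closes s w → Closes s (x ∷ u ++ complement x ∷ w)
  closes-wrap x    bu (done bv)                     = done (wrap x bu bv)
  closes-wrap x {u} bu (close {c} {v = v} {w} bv cl) =
    subst (Closes _) (cong (x ∷_) (++-assoc u (complement x ∷ v) (complement c ∷ w))) (close (wrap x bu bv) cl)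

  closes-push : ∀ {x s w} → Closes (x ∷ s) w → Closes s (x ∷ w)
  closes-push (close bu cl) = closes-wrap _ bu cl

  reduce≡[]⇒closes : ∀ s w → reduce s w ≡ [] → Closes s w
  reduce≡[]⇒closes []      []      _ = done []
  reduce≡[]⇒closes []      (x ∷ w) e = closes-push (reduce≡[]⇒closes (x ∷ []) w e)
  reduce≡[]⇒closes (c ∷ t) (x ∷ w) e with x ≟ complement c
  ... | yes refl = close [] (reduce≡[]⇒closes t w e)
  ... | no  _    = closes-push (reduce≡[]⇒closes (x ∷ c ∷ t) w e)

  reduce≡[]⇔balanced : ∀ {w} → reduce [] w ≡ [] ⇔ Balanced w
  reduce≡[]⇔balanced {w} = mk⇔ (λ e → closed (reduce≡[]⇒closes [] w e)) (λ bw → reduce-balanced bw [])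
    where
    closed : Closes [] w → Balanced w
    closed (done bw) = bw

  emptyingWords : List L → (k : ℕ) → List (Vec L k)
  emptyingWords s       (suc k) = consEach letters (λ x → emptyingWords (step s x) k)
  emptyingWords []      zero    = [] ∷ []
  emptyingWords (_ ∷ _) zero    = []

  ∈-emptyingWords⁺ : ∀ {s k} (v : Vec L k) → reduce s (toList v) ≡ [] → v ∈ emptyingWords s k
  ∈-emptyingWords⁺ {[]}    []      _ = here refl
  ∈-emptyingWords⁺ {s}     (x ∷ v) e = ∈-consEach⁺ (λ x → emptyingWords (step s x) _) (∈-letters x) (∈-emptyingWords⁺ v e)

  ∈-emptyingWords⁻ : ∀ {s k} (v : Vec L k) → v ∈ emptyingWords s k → reduce s (toList v) ≡ []
  ∈-emptyingWords⁻ {[]}    []      _  = refl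
  ∈-emptyingWords⁻ {s}     (x ∷ v) v∈ = ∈-emptyingWords⁻ v (proj₂ (∈-consEach⁻ letters _ v∈))

  ∈-emptyingWords : ∀ {s k} (v : Vec L k) → v ∈ emptyingWords s k ⇔ reduce s (toList v) ≡ []
  ∈-emptyingWords v = mk⇔ (∈-emptyingWords⁻ v) (∈-emptyingWords⁺ v)

  emptyingWords-unique : ∀ s k → Unique (emptyingWords s k)
  emptyingWords-unique []      zero    = [] ∷ []
  emptyingWords-unique (_ ∷ _) zero    = []
  emptyingWords-unique s       (suc k) = consEach-unique _ letters-unique (λ x → emptyingWords-unique (step s x) k)

  open Paths (2 * m) (2 * m ∸ 1)

  length-emptyingWords : ∀ s k → length (emptyingWords s k) ≡ paths (length s) k
  length-emptyingWords []      zero    = refl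
  length-emptyingWords (_ ∷ _) zero    = refl
  length-emptyingWords []      (suc k) = begin
    length (consEach letters (λ x → emptyingWords (x ∷ []) k))      ≡⟨ length-consEach letters _ ⟩
    sum (map (λ x → length (emptyingWords (x ∷ []) k)) letters)     ≡⟨ sum-map-≡ _ {xs = letters} (All.tabulate (λ {x} _ → length-emptyingWords (x ∷ []) k)) ⟩
    length letters * paths 1 k                                 ≡⟨ cong (_* paths 1 k) length-letters ⟩
    2 * m * paths 1 k                                          ∎
  length-emptyingWords (c ∷ t) (suc k) = begin
    length (consEach letters (λ x → emptyingWords (step (c ∷ t) x) k))   ≡⟨ length-consEach letters _ ⟩
    sum (map (λ x → length (emptyingWords (step (c ∷ t) x) k)) letters)  ≡⟨ sum-map-except _ pushed letters-unique (∈-letters (complement c)) ⟩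
    length (emptyingWords (step (c ∷ t) (complement c)) k) + (length letters ∸ 1) * paths (2 + length t) k
                                                                    ≡⟨ cong₂ (λ x y → x + (y ∸ 1) * paths (2 + length t) k) cancelled length-letters ⟩
    paths (length t) k + (2 * m ∸ 1) * paths (2 + length t) k       ∎
    where
    cancelled : length (emptyingWords (step (c ∷ t) (complement c)) k) ≡ paths (length t) k
    cancelled = trans (cong (λ s → length (emptyingWords s k)) (step-cancel refl)) (length-emptyingWords t k)
    pushed : ∀ x → x ≢ complement c → length (emptyingWords (step (c ∷ t) x) k) ≡ paths (2 + length t) k
    pushed x x≢c̄ = trans (cong (λ s → length (emptyingWords s k)) (step-push x≢c̄)) (length-emptyingWords (x ∷ c ∷ t) k)

-- Plane trees

shift : ℕ → ℕ × ℕ → ℕ × ℕ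
shift k (i , j) = (k + i , k + j)

edgePairsF-shift : ∀ ts k s → edgePairsF ts (k + s) ≡ map (shift k) (edgePairsF ts s)
edgePairsF-shift []            k s = refl
edgePairsF-shift (node cs ∷ ts) k s = cong₂ _∷_
  (cong (k + s ,_) (k+s+e+1≡k+[s+e+1] k s (2 * edgesF cs)))
  (begin
    edgePairsF cs (suc (k + s)) ++ edgePairsF ts (k + s + 2 * edgesF cs + 2)
      ≡⟨ cong₂ (λ x y → edgePairsF cs x ++ edgePairsF ts y) (sym (+-suc k s)) (k+s+e+2≡k+[s+e+2] k s (2 * edgesF cs)) ⟩
    edgePairsF cs (k + suc s) ++ edgePairsF ts (k + (s + 2 * edgesF cs + 2))
      ≡⟨ cong₂ _++_ (edgePairsF-shift cs k (suc s)) (edgePairsF-shift ts k (s + 2 * edgesF cs + 2)) ⟩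
    map (shift k) (edgePairsF cs (suc s)) ++ map (shift k) (edgePairsF ts (s + 2 * edgesF cs + 2))
      ≡⟨ map-++ (shift k) (edgePairsF cs (suc s)) _ ⟨
    map (shift k) (edgePairsF cs (suc s) ++ edgePairsF ts (s + 2 * edgesF cs + 2)) ∎)
  where
  k+s+e+1≡k+[s+e+1] : ∀ k s e → k + s + e + 1 ≡ k + (s + e + 1)
  k+s+e+1≡k+[s+e+1] = solve-∀
  k+s+e+2≡k+[s+e+2] : ∀ k s e → k + s + e + 2 ≡ k + (s + e + 2)
  k+s+e+2≡k+[s+e+2] = solve-∀

edgePairsF-from : ∀ ts k → edgePairsF ts k ≡ map (shift k) (edgePairsF ts 0)
edgePairsF-from ts k = trans (cong (edgePairsF ts) (sym (+-identityʳ k))) (edgePairsF-shift ts k 0)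

module ValidTrees (m : ℕ) where

  open FreeReduction m

  -- Positions are read through a lookup function, so that the same notion covers Defs.letterAt (1-based) and _!?_ (0-based).
  Complementary : (ℕ → Maybe L) → ℕ × ℕ → Set
  Complementary f (i , j) = Σ L λ a → f i ≡ just a × f j ≡ just (complement a)

  complementary-shift : ∀ {f g} ts k → (∀ i → f (k + i) ≡ g i) →
                        All (Complementary f) (edgePairsF ts k) ⇔ All (Complementary g) (edgePairsF ts 0)
  complementary-shift {f} {g} ts k f≗g = mk⇔
    (λ ok → All.map (λ { {i , j} → transport (f≗g i) (f≗g j) }) (map⁻ (subst (All _) (edgePairsF-from ts k) ok)))
    (λ ok → subst (All _) (sym (edgePairsF-from ts k)) (map⁺ (All.map (λ { {i , j} → transport (sym (f≗g i)) (sym (f≗g j)) }) ok)))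
    where
    transport : ∀ {x y x′ y′} → x ≡ x′ → y ≡ y′ → Σ L (λ a → x ≡ just a × y ≡ just (complement a)) →
                Σ L (λ a → x′ ≡ just a × y′ ≡ just (complement a))
    transport refl refl c = c

  complementary-++ : ∀ xs {ys p} → Complementary (xs !?_) p → Complementary ((xs ++ ys) !?_) p
  complementary-++ xs (a , xs!?i≡a , xs!?j≡ā) = a , !?-++ˡ xs xs!?i≡a , !?-++ˡ xs xs!?j≡ā

  closing-position : ∀ (x : L) u e → length u ≡ 2 * e → 2 * e + 1 ≡ length (x ∷ u) + 0
  closing-position x u e |u|≡2e = trans (cong (_+ 1) (sym |u|≡2e)) (n+1≡1+n+0 (length u))
    where
    n+1≡1+n+0 : ∀ n → n + 1 ≡ suc n + 0
    n+1≡1+n+0 = solve-∀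

  siblings-position : ∀ (x : L) u e → length u ≡ 2 * e → ∀ i → 2 * e + 2 + i ≡ length (x ∷ u) + suc i
  siblings-position x u e |u|≡2e i = trans (cong (λ l → l + 2 + i) (sym |u|≡2e)) (n+2+i≡1+n+[1+i] (length u) i)
    where
    n+2+i≡1+n+[1+i] : ∀ n i → n + 2 + i ≡ suc n + suc i
    n+2+i≡1+n+[1+i] = solve-∀

  length-wrap : ∀ (x : L) u v e e′ → length u ≡ 2 * e → length v ≡ 2 * e′ →
                length (x ∷ u ++ complement x ∷ v) ≡ 2 * (suc e + e′)
  length-wrap x u v e e′ |u|≡2e |v|≡2e′ = begin
    suc (length (u ++ complement x ∷ v))        ≡⟨ cong suc (length-++ u) ⟩
    suc (length u + suc (length v))             ≡⟨ cong₂ (λ a b → suc (a + suc b)) |u|≡2e |v|≡2e′ ⟩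
    suc (2 * e + suc (2 * e′))                  ≡⟨ 1+2e+[1+2e′]≡2[1+e+e′] e e′ ⟩
    2 * (suc e + e′)                            ∎
    where
    1+2e+[1+2e′]≡2[1+e+e′] : ∀ e e′ → suc (2 * e + suc (2 * e′)) ≡ 2 * (suc e + e′)
    1+2e+[1+2e′]≡2[1+e+e′] = solve-∀

  balanced⇒forest : ∀ {w} → Balanced w →
                    Σ (List Tree) λ ts → length w ≡ 2 * edgesF ts × All (Complementary (w !?_)) (edgePairsF ts 0)
  balanced⇒forest []                     = [] , refl , []
  balanced⇒forest (wrap x {u} {v} bu bv) with balanced⇒forest bu | balanced⇒forest bv
  ... | cs , |u|≡2e , cs-ok | ts , |v|≡2e′ , ts-ok =
    node cs ∷ ts , length-wrap x u v (edgesF cs) (edgesF ts) |u|≡2e |v|≡2e′ , (x , refl , closing) ∷ ++⁺ children siblings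
    where
    w : List L
    w = x ∷ u ++ complement x ∷ v
    closing : w !? (2 * edgesF cs + 1) ≡ just (complement x)
    closing = !?-++ʳ (x ∷ u) (closing-position x u (edgesF cs) |u|≡2e)
    children : All (Complementary (w !?_)) (edgePairsF cs 1)
    children = Equivalence.from (complementary-shift cs 1 (λ _ → refl)) (All.map (complementary-++ u) cs-ok)
    siblings : All (Complementary (w !?_)) (edgePairsF ts (2 * edgesF cs + 2))
    siblings = Equivalence.from (complementary-shift ts _ (λ i → !?-++ʳ (x ∷ u) (siblings-position x u (edgesF cs) |u|≡2e i))) ts-ok

  forest⇒balanced : ∀ ts {xs} → All (Complementary (xs !?_)) (edgePairsF ts 0) →
                    ∃₂ λ w post → xs ≡ w ++ post × Balanced w × length w ≡ 2 * edgesF ts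
  forest⇒balanced []             _ = [] , _ , refl , [] , refl
  forest⇒balanced (node cs ∷ ts) {[]}     ((_ , () , _) ∷ _)
  forest⇒balanced (node cs ∷ ts) {x ∷ xs} ((_ , refl , closes) ∷ rest) with ++⁻ (edgePairsF cs 1) rest
  ... | cs-ok , ts-ok with forest⇒balanced cs {xs} (Equivalence.to (complementary-shift cs 1 (λ _ → refl)) cs-ok)
  ... | u , post₁ , refl , bu , |u|≡2e
    with !?0≡just⇒≡∷ {xs = post₁} (trans (sym (!?-++ʳ (x ∷ u) (closing-position x u (edgesF cs) |u|≡2e))) closes)
  ... | rest₂ , refl
    with forest⇒balanced ts {rest₂}
           (Equivalence.to (complementary-shift ts _ (λ i → !?-++ʳ (x ∷ u) (siblings-position x u (edgesF cs) |u|≡2e i))) ts-ok)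
  ... | v , post , refl , bv , |v|≡2e′ =
    x ∷ u ++ complement x ∷ v , post , cong (x ∷_) (sym (++-assoc u (complement x ∷ v) post)) ,
    wrap x bu bv , length-wrap x u v (edgesF cs) (edgesF ts) |u|≡2e |v|≡2e′

  balanced⇔inP : ∀ {n} (P : Word n m) → Balanced (toList P) ⇔ InP n m P
  balanced⇔inP {n} P = mk⇔ balanced⇒inP inP⇒balanced
    where
    inP⇒balanced : InP n m P → Balanced (toList P)
    inP⇒balanced (node ts , edges≡n , valid)
      with forest⇒balanced ts (Equivalence.to (complementary-shift ts 1 (letterAt-toList P)) valid)
    ... | w , post , P≡w++post , bw , |w|≡2e = subst Balanced (sym P≡w) bw
      where
      |w++post|≡|w| : length (w ++ post) ≡ length w
      |w++post|≡|w| = begin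
        length (w ++ post)   ≡⟨ cong length P≡w++post ⟨
        length (toList P)    ≡⟨ Vecₚ.length-toList P ⟩
        2 * n                ≡⟨ cong (2 *_) edges≡n ⟨
        2 * edgesF ts        ≡⟨ |w|≡2e ⟨
        length w             ∎
      P≡w : toList P ≡ w
      P≡w = trans P≡w++post (trans (cong (w ++_) (++-length≡⇒[] w |w++post|≡|w|)) (++-identityʳ w))
    balanced⇒inP : Balanced (toList P) → InP n m P
    balanced⇒inP bP with balanced⇒forest bP
    ... | ts , |P|≡2e , ok = node ts , *-cancelˡ-≡ (edgesF ts) n 2 (trans (sym |P|≡2e) (Vecₚ.length-toList P)) ,
                             Equivalence.from (complementary-shift ts 1 (letterAt-toList P)) ok

mainTheorem15 : (n m : ℕ) → 1 ≤ n → 1 ≤ m →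
    ∃ λ (Ws : List (Word n m)) → ∃ λ (Cs : List (List ℕ)) →
      Unique Ws × (∀ P → (P ∈ Ws) ⇔ InP n m P) ×
      Unique Cs × (∀ c → (c ∈ Cs) ⇔ IsComposition n c) ×
      length Ws ≡ sum (map (term n m) Cs)
mainTheorem15 n m _ _ =
  emptyingWords [] (2 * n) , compositions n ,
  emptyingWords-unique [] (2 * n) , (λ P → balanced⇔inP P ⇔-∘ (reduce≡[]⇔balanced ⇔-∘ ∈-emptyingWords P)) ,
  compositions-unique n , (λ c → mk⇔ (All.lookup (compositions-sound n)) ∈-compositions⁺) ,
  count
  where
  open FreeReduction m
  open ValidTrees m
  open Paths (2 * m) (2 * m ∸ 1)
  open CompositionSum (2 * m) (2 * m ∸ 1)
  count : length (emptyingWords [] (2 * n)) ≡ compositionSum n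
  count = begin
    length (emptyingWords [] (2 * n))  ≡⟨ length-emptyingWords [] (2 * n) ⟩
    paths 0 (2 * n)                    ≡⟨ cong (paths 0) (2n≡n+n+0 n) ⟩
    paths 0 (n + n + 0)                ≡⟨ paths≡pathsByUps 0 n ⟩
    pathsByUps 0 n                     ≡⟨ compositionSum≡pathsByUps n ⟨
    compositionSum n                   ∎
    where
    2n≡n+n+0 : ∀ n → 2 * n ≡ n + n + 0
    2n≡n+n+0 = solve-∀
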